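{- Let $k\ge1$ and let $\mathcal{M}_k$ and its $k$-boxes $\mathcal{B}_1,\dots,\mathcal{B}_k$ be as defined in the context. For every set $\mathcal{I}\subseteq\mathcal{M}_k$ of pairwise disjoint segments, at most two of the boxes $\mathcal{B}_1,\dots,\mathcal{B}_k$ are interesting for $\mathcal{I}$.
   Context: Fix an integer $k\ge1$ and let $N=2k(k+1)+1$; all segments below are closed. For $i,j\in\{1,\dots,k\}$ define: the vertical line $x=2ki+2j-1$ with meeting point $p_{i,j}=(2ki+2j-1,\,2ki-2j+1)$, carrying the up segment $\{2ki+2j-1\}\times[2ki-2j+1,N]$ and the down segment $\{2ki+2j-1\}\times[-1,2ki-2j+1]$; and the horizontal line $y=2ki-2j$ with meeting point $q_{i,j}=(2ki+2j,\,2ki-2j)$, carrying the right segment $[2ki+2j,N]\times\{2ki-2j\}$ and the left segment $[-1,2ki+2j]\times\{2ki-2j\}$. The $k$-box $\mathcal{B}_i$ is the set of the $4k$ segments (up, down, right and left segments) with index $i$ and $j=1,\dots,k$; $\mathcal{M}_k=\bigcup_{i=1}^k\mathcal{B}_i$ has $4k^2$ segments. (Thus within each box the meeting points lie along a top-left to bottom-right diagonal, the boxes are placed along a bottom-left to top-right diagonal of the square $[-1,N]^2$, and every segment extends from its meeting point to the boundary of this square.) Given a set $\mathcal{I}$ of pairwise disjoint segments of $\mathcal{M}_k$, a box $\mathcal{B}_i$ is interesting for $\mathcal{I}$ if $\mathcal{B}_i\cap\mathcal{I}$ contains at least one down segment and at least one right segment, or contains at least one up segment and at least one left segment; otherwise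 $\mathcal{B}_i$ is boring for $\mathcal{I}$. -}

module Defs where

open import Data.Nat using (ℕ; suc)
open import Data.Fin using (Fin; toℕ)
open import Data.Integer as Z using (ℤ; +_; -[1+_])
open import Data.Rational as Q using (ℚ; _/_)
open import Data.Product using (_×_; _,_; Σ; ∃; proj₁)
open import Data.Sum using (_⊎_)
open import Relation.Nullary using (¬_)
open import Relation.Binary.PropositionalEquality using (_≡_)

-- Closed axis-parallel segments in the plane (integer endpoints),
-- with points of the plane taken in ℚ × ℚ (no reals in agda-stdlib).

data Segment : Set where
  vert : (x lo hi : ℤ) → Segment
  hor  : (y lo hi : ℤ) → Segment

ι : ℤ → ℚ
ι z = z / 1

_∈ₛ_ : ℚ × ℚ → Segment → Set
(px , py) ∈ₛ vert x lo hi = px ≡ ι x × ι lo Q.≤ py × py Q.≤ ι hi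
(px , py) ∈ₛ hor y lo hi  = py ≡ ι y × ι lo Q.≤ px × px Q.≤ ι hi

DisjointSeg : Segment → Segment → Set
DisjointSeg s t = ¬ (Σ (ℚ × ℚ) λ p → p ∈ₛ s × p ∈ₛ t)

data Kind : Set where
  up down right left : Kind

-- a segment of M_k is labelled by (i , j , kind) with i , j ∈ {1..k}
-- represented by Fin k (value toℕ i + 1).
Label : ℕ → Set
Label k = Fin k × Fin k × Kind

box : ∀ {k} → Label k → Fin k
box = proj₁

idx : ∀ {k} → Fin k → ℤ
idx i = + suc (toℕ i)

bigN : ℕ → ℤ
bigN k = + (2 * k * (k + 1) + 1)
  where open Data.Nat using (_*_; _+_)

-1ℤ : ℤ
-1ℤ = -[1+ 0 ]

seg : (k : ℕ) → Label k → Segment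
seg k (i , j , kind) = go kind
  where
  open Z using (_*_; _+_; _-_)
  K = + k
  vx = + 2 * K * idx i + + 2 * idx j - + 1
  vy = + 2 * K * idx i - + 2 * idx j + + 1
  hy = + 2 * K * idx i - + 2 * idx j
  hx = + 2 * K * idx i + + 2 * idx j
  go : Kind → Segment
  go up    = vert vx vy (bigN k)
  go down  = vert vx -1ℤ vy
  go right = hor hy hx (bigN k)
  go left  = hor hy -1ℤ hx

PairwiseDisjoint : (k : ℕ) → (Label k → Set) → Set
PairwiseDisjoint k I =
  ∀ s t → I s → I t → ¬ (s ≡ t) → DisjointSeg (seg k s) (seg k t)

HasKind : (k : ℕ) → (Label k → Set) → Fin k → Kind → Set
HasKind k I i kind = ∃ λ j → I (i , j , kind)

Interesting : (k : ℕ) → (Label k → Set) → Fin k → Set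
Interesting k I i =
  (HasKind k I i down × HasKind k I i right)
  ⊎ (HasKind k I i up × HasKind k I i left)

{-# OPTIONS --safe #-}
-- Write base i = 2ki, width = 2k and offset j = 2j, so that
-- p_{i,j} = (base i + offset j - 1, base i - offset j + 1) and
-- q_{i,j} = (base i + offset j, base i - offset j). Since 1 ≤ j ≤ k, every meeting
-- point of B_i has its x-coordinate in [base i, base i + width] and its
-- y-coordinate in [base i - width, base i], and base increases by at least
-- width from one box to the next.
-- Hence, for boxes a < b, each right segment of B_a crosses each down segment
-- of B_b, and each up segment of B_a crosses each left segment of B_b. So at
-- most one box contains both a down and a right segment of I, and at most one
-- contains both an up and a left segment; since an interesting box is of one of
-- these two types, there are at most two interesting boxes.
module Submission where

open import Defs
open import Data.Nat as ℕ using (ℕ; _≥_; suc; s≤s; z≤n)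
import Data.Nat.Properties as ℕP
open import Data.Integer as ℤ using (ℤ; +_; +≤+; -≤+; 0ℤ; _≤_; _+_; _-_; _*_)
import Data.Integer.Properties as ℤP
open import Data.Integer.Tactic.RingSolver using (solve-∀)
open import Data.Rational as ℚ using (mkℚ)
import Data.Rational.Properties as ℚP
import Data.Nat.Coprimality as Coprimality
open import Data.Fin as Fin using (Fin; toℕ)
import Data.Fin.Properties as FinP
open import Data.Product using (_×_; _,_; proj₁; proj₂)
open import Data.Sum using (_⊎_; inj₁; inj₂)
open import Data.Empty using (⊥)
open import Relation.Nullary using (¬_)
open import Relation.Binary.Definitions using (tri<; tri≈; tri>)
open import Relation.Binary.PropositionalEquality
  using (_≡_; _≢_; refl; sym; trans; cong; cong₂; subst; subst₂; module ≡-Reasoning)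

ι≡mkℚ : ∀ z → ι z ≡ mkℚ z 0 (Coprimality.sym (Coprimality.1-coprimeTo ℤ.∣ z ∣))
ι≡mkℚ z = ℚP.↥p/↧p≡p _

ι-mono : ∀ {x y} → x ≤ y → ι x ℚ.≤ ι y
ι-mono {x} {y} x≤y rewrite ι≡mkℚ x | ι≡mkℚ y =
  ℚ.*≤* (subst₂ _≤_ (sym (ℤP.*-identityʳ x)) (sym (ℤP.*-identityʳ y)) x≤y)

infix 4 _∈[_,_]
_∈[_,_] : ℤ → ℤ → ℤ → Set
x ∈[ l , h ] = l ≤ x × x ≤ h

vert-hor-meet : ∀ {x ylo yhi y xlo xhi} → y ∈[ ylo , yhi ] → x ∈[ xlo , xhi ] →
                ¬ DisjointSeg (vert x ylo yhi) (hor y xlo xhi)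
vert-hor-meet (ylo≤y , y≤yhi) (xlo≤x , x≤xhi) disjoint =
  disjoint (_ , (refl , ι-mono ylo≤y , ι-mono y≤yhi) , (refl , ι-mono xlo≤x , ι-mono x≤xhi))

i+j∈[i,i+k] : ∀ i {j k} → j ∈[ 0ℤ , k ] → i + j ∈[ i , i + k ]
i+j∈[i,i+k] i (0≤j , j≤k) =
  subst (_≤ i + _) (ℤP.+-identityʳ i) (ℤP.+-monoʳ-≤ i 0≤j) , ℤP.+-monoʳ-≤ i j≤k

i-j∈[i-k,i] : ∀ i {j k} → j ∈[ 0ℤ , k ] → i - j ∈[ i - k , i ]
i-j∈[i-k,i] i (0≤j , j≤k) =
  ℤP.+-monoʳ-≤ i (ℤP.neg-mono-≤ j≤k) ,
  subst (i - _ ≤_) (ℤP.+-identityʳ i) (ℤP.+-monoʳ-≤ i (ℤP.neg-mono-≤ 0≤j))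

j-1∈[0,k] : ∀ {j k} → j ∈[ + 1 , k ] → j - + 1 ∈[ 0ℤ , k ]
j-1∈[0,k] (1≤j , j≤k) = ℤP.i≤j⇒0≤j-i 1≤j , ℤP.i≤j⇒i-k≤j (+ 1) j≤k

i+j-1∈[i,i+k] : ∀ i {j k} → j ∈[ + 1 , k ] → i + j - + 1 ∈[ i , i + k ]
i+j-1∈[i,i+k] i {j} j∈ =
  subst (_∈[ i , i + _ ]) (sym (ℤP.+-assoc i j (ℤ.- + 1))) (i+j∈[i,i+k] i (j-1∈[0,k] j∈))

i-j+1∈[i-k,i] : ∀ i {j k} → j ∈[ + 1 , k ] → i - j + + 1 ∈[ i - k , i ]
i-j+1∈[i-k,i] i {j} j∈ = subst (_∈[ i - _ , i ]) (reassoc i j) (i-j∈[i-k,i] i (j-1∈[0,k] j∈))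
  where
  reassoc : ∀ i j → i - (j - + 1) ≡ i - j + + 1
  reassoc = solve-∀

i+j≤k⇒i≤k-j : ∀ {i j k} → i + j ≤ k → i ≤ k - j
i+j≤k⇒i≤k-j {i} {j} i+j≤k = subst (_≤ _) (cancel i j) (ℤP.+-monoˡ-≤ (ℤ.- j) i+j≤k)
  where
  cancel : ∀ i j → i + j - j ≡ i
  cancel = solve-∀

AtMostOne : ∀ {A : Set} → (A → Set) → Set
AtMostOne P = ∀ {x y} → x ≢ y → P x → P y → ⊥

atMostOne⊎atMostOne⇒¬three : ∀ {A : Set} {P Q : A → Set} →
  AtMostOne P → AtMostOne Q → ∀ {x y z} → x ≢ y → x ≢ z → y ≢ z →
  P x ⊎ Q x → P y ⊎ Q y → P z ⊎ Q z → ⊥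
atMostOne⊎atMostOne⇒¬three p q x≢y x≢z y≢z (inj₁ px) (inj₁ py) _        = p x≢y px py
atMostOne⊎atMostOne⇒¬three p q x≢y x≢z y≢z (inj₁ px) (inj₂ _)  (inj₁ pz) = p x≢z px pz
atMostOne⊎atMostOne⇒¬three p q x≢y x≢z y≢z (inj₁ _)  (inj₂ qy) (inj₂ qz) = q y≢z qy qz
atMostOne⊎atMostOne⇒¬three p q x≢y x≢z y≢z (inj₂ qx) (inj₂ qy) _        = q x≢y qx qy
atMostOne⊎atMostOne⇒¬three p q x≢y x≢z y≢z (inj₂ qx) (inj₁ _)  (inj₂ qz) = q x≢z qx qz
atMostOne⊎atMostOne⇒¬three p q x≢y x≢z y≢z (inj₂ _)  (inj₁ py) (inj₁ pz) = p y≢z py pz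

<-incompatible⇒atMostOne : ∀ {n} {P : Fin n → Set} →
  (∀ {a b} → a Fin.< b → P a → P b → ⊥) → AtMostOne P
<-incompatible⇒atMostOne incompatible {a} {b} a≢b Pa Pb with FinP.<-cmp a b
... | tri< a<b _ _ = incompatible a<b Pa Pb
... | tri≈ _ a≡b _ = a≢b a≡b
... | tri> _ _ b<a = incompatible b<a Pb Pa

module _ (k : ℕ) where

  width : ℤ
  width = + 2 * + k

  base : Fin k → ℤ
  base i = width * idx i

  offset : Fin k → ℤ
  offset j = + 2 * idx j

  XBand YBand : Fin k → ℤ → Set
  XBand i x = x ∈[ base i , base i + width ]
  YBand i y = y ∈[ base i - width , base i ]

  offset∈[1,width] : ∀ j → offset j ∈[ + 1 , width ]
  offset∈[1,width] j = +≤+ (s≤s z≤n) , ℤP.*-monoˡ-≤-nonNeg (+ 2) (+≤+ (FinP.toℕ<n j))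

  offset∈[0,width] : ∀ j → offset j ∈[ 0ℤ , width ]
  offset∈[0,width] j = +≤+ z≤n , proj₂ (offset∈[1,width] j)

  p-x∈XBand : ∀ i j → XBand i (base i + offset j - + 1)
  p-x∈XBand i j = i+j-1∈[i,i+k] (base i) (offset∈[1,width] j)

  p-y∈YBand : ∀ i j → YBand i (base i - offset j + + 1)
  p-y∈YBand i j = i-j+1∈[i-k,i] (base i) (offset∈[1,width] j)

  q-x∈XBand : ∀ i j → XBand i (base i + offset j)
  q-x∈XBand i j = i+j∈[i,i+k] (base i) (offset∈[0,width] j)

  q-y∈YBand : ∀ i j → YBand i (base i - offset j)
  q-y∈YBand i j = i-j∈[i-k,i] (base i) (offset∈[0,width] j)

  width≡ : width ≡ + (2 ℕ.* k)
  width≡ = sym (ℤP.pos-* 2 k)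

  0≤width : 0ℤ ≤ width
  0≤width = subst (0ℤ ≤_) (sym width≡) (+≤+ z≤n)

  base≡ : ∀ i → base i ≡ + (2 ℕ.* k ℕ.* suc (toℕ i))
  base≡ i = trans (cong (_* idx i) width≡) (sym (ℤP.pos-* (2 ℕ.* k) _))

  base+width≡ : ∀ i → base i + width ≡ + (2 ℕ.* k ℕ.* suc (suc (toℕ i)))
  base+width≡ i = trans (cong₂ _+_ (base≡ i) width≡) (cong +_ (begin
    2 ℕ.* k ℕ.* suc (toℕ i) ℕ.+ 2 ℕ.* k  ≡⟨ ℕP.+-comm (2 ℕ.* k ℕ.* _) (2 ℕ.* k) ⟩
    2 ℕ.* k ℕ.+ 2 ℕ.* k ℕ.* suc (toℕ i)  ≡⟨ ℕP.*-suc (2 ℕ.* k) _ ⟨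
    2 ℕ.* k ℕ.* suc (suc (toℕ i))        ∎))
    where open ≡-Reasoning

  base-width≡ : ∀ i → base i - width ≡ + (2 ℕ.* k ℕ.* toℕ i)
  base-width≡ i =
    trans (peel width (+ toℕ i)) (trans (cong (_* + toℕ i) width≡) (sym (ℤP.pos-* (2 ℕ.* k) _)))
    where
    peel : ∀ w t → w * (+ 1 + t) - w ≡ w * t
    peel = solve-∀

  base-gap : ∀ {a b} → a Fin.< b → base a + width ≤ base b
  base-gap {a} {b} a<b =
    subst₂ _≤_ (sym (base+width≡ a)) (sym (base≡ b)) (+≤+ (ℕP.*-monoʳ-≤ (2 ℕ.* k) (s≤s a<b)))

  -1≤base-width : ∀ i → -1ℤ ≤ base i - width
  -1≤base-width i = subst (-1ℤ ≤_) (sym (base-width≡ i)) -≤+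

  base+width≤N : ∀ i → base i + width ≤ bigN k
  base+width≤N i = subst (_≤ bigN k) (sym (base+width≡ i)) (+≤+ (ℕP.≤-trans
    (ℕP.*-monoʳ-≤ (2 ℕ.* k) (subst (suc (suc (toℕ i)) ℕ.≤_) (ℕP.+-comm 1 k) (s≤s (FinP.toℕ<n i))))
    (ℕP.m≤m+n _ 1)))

  XBand⊆frame : ∀ i {x} → XBand i x → x ∈[ -1ℤ , bigN k ]
  XBand⊆frame i (base≤x , x≤base+width) =
    ℤP.≤-trans (-1≤base-width i) (ℤP.≤-trans (proj₂ (i-j∈[i-k,i] (base i) (0≤width , ℤP.≤-refl))) base≤x) ,
    ℤP.≤-trans x≤base+width (base+width≤N i)

  YBand⊆frame : ∀ i {y} → YBand i y → y ∈[ -1ℤ , bigN k ]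
  YBand⊆frame i (base-width≤y , y≤base) =
    ℤP.≤-trans (-1≤base-width i) base-width≤y ,
    ℤP.≤-trans y≤base (ℤP.≤-trans (proj₁ (i+j∈[i,i+k] (base i) (0≤width , ℤP.≤-refl))) (base+width≤N i))

  XBand-ordered : ∀ {a b x x′} → a Fin.< b → XBand a x → XBand b x′ → x ≤ x′
  XBand-ordered a<b (_ , x≤) (≤x′ , _) = ℤP.≤-trans x≤ (ℤP.≤-trans (base-gap a<b) ≤x′)

  YBand-ordered : ∀ {a b y y′} → a Fin.< b → YBand a y → YBand b y′ → y ≤ y′
  YBand-ordered a<b (_ , y≤) (≤y′ , _) = ℤP.≤-trans y≤ (ℤP.≤-trans (i+j≤k⇒i≤k-j (base-gap a<b)) ≤y′)

  right-meets-down : ∀ {a b} j j′ → a Fin.< b →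
                     ¬ DisjointSeg (seg k (b , j′ , down)) (seg k (a , j , right))
  right-meets-down {a} {b} j j′ a<b = vert-hor-meet
    (proj₁ (YBand⊆frame a (q-y∈YBand a j)) , YBand-ordered a<b (q-y∈YBand a j) (p-y∈YBand b j′))
    (XBand-ordered a<b (q-x∈XBand a j) (p-x∈XBand b j′) , proj₂ (XBand⊆frame b (p-x∈XBand b j′)))

  up-meets-left : ∀ {a b} j j′ → a Fin.< b →
                  ¬ DisjointSeg (seg k (a , j , up)) (seg k (b , j′ , left))
  up-meets-left {a} {b} j j′ a<b = vert-hor-meet
    (YBand-ordered a<b (p-y∈YBand a j) (q-y∈YBand b j′) , proj₂ (YBand⊆frame b (q-y∈YBand b j′)))
    (proj₁ (XBand⊆frame a (p-x∈XBand a j)) , XBand-ordered a<b (p-x∈XBand a j) (q-x∈XBand b j′))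

  module _ (I : Label k → Set) (disjoint : PairwiseDisjoint k I) where

    DownRight UpLeft : Fin k → Set
    DownRight i = HasKind k I i down × HasKind k I i right
    UpLeft i = HasKind k I i up × HasKind k I i left

    downRight-atMostOne : AtMostOne DownRight
    downRight-atMostOne = <-incompatible⇒atMostOne crossing
      where
      crossing : ∀ {a b} → a Fin.< b → DownRight a → DownRight b → ⊥
      crossing {a} {b} a<b (_ , j , right∈I) ((j′ , down∈I) , _) =
        right-meets-down j j′ a<b (disjoint (b , j′ , down) (a , j , right) down∈I right∈I λ ())

    upLeft-atMostOne : AtMostOne UpLeft
    upLeft-atMostOne = <-incompatible⇒atMostOne crossing
      where
      crossing : ∀ {a b} → a Fin.< b → UpLeft a → UpLeft b → ⊥
      crossing {a} {b} a<b ((j , up∈I) , _) (_ , j′ , left∈I) =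
        up-meets-left j j′ a<b (disjoint (a , j , up) (b , j′ , left) up∈I left∈I λ ())

lemma12 : (k : ℕ) → k ≥ 1 → (I : Label k → Set) → PairwiseDisjoint k I →
          (a b c : Fin k) → ¬ (a ≡ b) → ¬ (a ≡ c) → ¬ (b ≡ c) →
          Interesting k I a → Interesting k I b → Interesting k I c → ⊥
lemma12 k _ I disjoint a b c =
  atMostOne⊎atMostOne⇒¬three (downRight-atMostOne k I disjoint) (upLeft-atMostOne k I disjoint)
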